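{- Let $G$ be a graph, $k\geq 1$ an integer, and $S=\{x_1,\ldots,x_k\}$ where $x_1,\ldots,x_k$ are distinct vertices of $G$. If $G-S$ is equitable list point $k$-arborable and $|N(x_i)\setminus S|\leq 2i-1$ for every $1\leq i\leq k$ (where $N(x)$ is the set of neighbors of $x$ in $G$), then $G$ is equitable list point $k$-arborable.
   Context: All graphs are finite, simple and undirected. A $k$-list assignment of a graph $G$ assigns to each vertex $v$ a set (list) $L(v)$ of $k$ colors. A graph $G$ is equitable list point $k$-arborable if for every $k$-list assignment $L$ one can choose $c(v)\in L(v)$ for each vertex $v$ such that each color class induces an acyclic subgraph (a forest) of $G$ and each color appears on at most $\lceil |V(G)|/k\rceil$ vertices of $G$. -}

module Defs where

open import Data.Nat using (ℕ; zero; suc; _+_; _*_; _≤_; _/_)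
open import Data.Bool using (Bool; true; false; _∧_; not; if_then_else_; T)
open import Data.Fin using (Fin; toℕ)
open import Data.List using (List; []; _∷_; _++_; take; length; map; allFin)
open import Data.Nat.ListAction using (sum)
open import Data.Bool.ListAction using (any)
open import Data.List.Membership.Propositional using (_∈_)
open import Data.List.Relation.Unary.All using (All)
open import Data.List.Relation.Unary.Unique.Propositional using (Unique)
open import Data.Product using (_×_; ∃)
open import Data.Unit using (⊤)
open import Relation.Nullary using (¬_)
open import Relation.Nullary.Decidable using (⌊_⌋)
open import Relation.Binary.PropositionalEquality using (_≡_)
import Data.Fin as F
import Data.Nat as N

record Graph (n : ℕ) : Set where
  field
    adj   : Fin n → Fin n → Bool
    sym   : ∀ u v → adj u v ≡ adj v u
    irref : ∀ v → adj v v ≡ false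
open Graph public

Edge : ∀ {n} → Graph n → Fin n → Fin n → Set
Edge G u v = T (adj G u v)

count : ∀ {n} → (Fin n → Bool) → ℕ
count {n} p = sum (map (λ v → if p v then 1 else 0) (allFin n))

-- ⌈ m / k ⌉ for k ≥ 1 (value at k = 0 is irrelevant)
⌈_/_⌉ : ℕ → ℕ → ℕ
⌈ m / zero ⌉ = 0
⌈ m / suc k ⌉ = (m + k) / suc k

Chain : ∀ {n} → Graph n → List (Fin n) → Set
Chain G [] = ⊤
Chain G (a ∷ []) = ⊤
Chain G (a ∷ b ∷ r) = Edge G a b × Chain G (b ∷ r)

-- vs = v₁ … v_m (m ≥ 3, distinct) is a cycle v₁ v₂ … v_m v₁ of G all of whose
-- vertices satisfy P (i.e. a cycle of the induced subgraph on P)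
IsCycleIn : ∀ {n} → Graph n → (Fin n → Bool) → List (Fin n) → Set
IsCycleIn G P vs =
  3 ≤ length vs × Unique vs × All (λ v → T (P v)) vs × Chain G (vs ++ take 1 vs)

AcyclicIn : ∀ {n} → Graph n → (Fin n → Bool) → Set
AcyclicIn G P = ∀ vs → ¬ IsCycleIn G P vs

-- The induced subgraph G[U] is equitable list point k-arborable:
-- for every k-list assignment L on the vertices of U there is a choice
-- c(v) ∈ L(v) such that every colour class induces a forest and every colour
-- is used on at most ⌈|U|/k⌉ vertices of U.
ELPA-on : ∀ {n} → Graph n → (Fin n → Bool) → ℕ → Set
ELPA-on G U k =
  (L : Fin _ → List ℕ) →
  (∀ v → T (U v) → length (L v) ≡ k × Unique (L v)) →
  ∃ λ (c : Fin _ → ℕ) →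
      (∀ v → T (U v) → c v ∈ L v)
    × (∀ (col : ℕ) → AcyclicIn G (λ v → U v ∧ ⌊ c v N.≟ col ⌋))
    × (∀ (col : ℕ) → count (λ v → U v ∧ ⌊ c v N.≟ col ⌋) ≤ ⌈ count U / k ⌉)

ELPA : ∀ {n} → Graph n → ℕ → Set
ELPA G k = ELPA-on G (λ _ → true) k

inS : ∀ {n k} → (Fin k → Fin n) → Fin n → Bool
inS {k = k} x v = any (λ j → ⌊ x j F.≟ v ⌋) (allFin k)

outsideS : ∀ {n k} → (Fin k → Fin n) → Fin n → Bool
outsideS x v = not (inS x v)

-- Colour G - S by hypothesis, then colour x_k, x_{k-1}, …, x_1 in this order with pairwise
-- distinct colours.  Call a colour crowded for x_i if x_i has at least two neighbours of
-- that colour outside S; since x_i has at most 2i - 1 such neighbours, at most i - 1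
-- colours of L(x_i) are crowded, and at most k - i are already used by x_{i+1}, …, x_k,
-- so a colour of L(x_i) remains.  Each new colour class is an old one (a forest) plus at
-- most one vertex with at most one neighbour in it, hence still a forest, and its size
-- grows by at most one: ⌈(n - k)/k⌉ + 1 = ⌈n/k⌉.
module Submission where

open import Defs hiding (sym)
open import Data.Nat as ℕ using (ℕ; zero; suc; _+_; _*_; _/_; _≤_; _<_; z≤n; s≤s)
open import Data.Nat.Properties
open import Data.Nat.DivMod using (/-monoˡ-≤; +-distrib-/-∣ʳ; n/n≡1)
open import Data.Nat.Divisibility using (∣-refl)
open import Data.Nat.ListAction using (sum)
open import Data.Bool using (Bool; true; false; _∧_; _∨_; not; if_then_else_; T)
open import Data.Bool.Properties using (T-∧; T-∨; ∧-assoc)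
open import Data.Bool.ListAction using (any)
open import Data.Fin as F using (Fin; toℕ; fromℕ; inject₁)
open import Data.Fin.Properties using (any?; toℕ-fromℕ; toℕ-inject₁)
open import Data.Fin.Relation.Unary.Top using (View; view; ‵fromℕ; ‵inject₁)
open import Data.List using (List; []; _∷_; _++_; [_]; length; map; take; allFin; initLast; _∷ʳ′_)
open import Data.List.Properties using (++-assoc; ++-identityʳ; length-tabulate)
open import Data.List.Membership.Propositional using (_∈_)
open import Data.List.Membership.Propositional.Properties using (∈-∃++; ∈-++⁺ʳ; ∈-allFin)
open import Data.List.Relation.Unary.Any as Any using (here; there; satisfied)
open import Data.List.Relation.Unary.Any.Properties using (any⁺; any⁻)
open import Data.List.Relation.Unary.All as All using (All)
open import Data.List.Relation.Unary.All.Properties using (All¬⇒¬Any)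
open import Data.List.Relation.Unary.AllPairs using ([]; _∷_)
open import Data.List.Relation.Unary.Unique.Propositional using (Unique)
open import Data.List.Relation.Unary.Unique.Propositional.Properties using (allFin⁺)
open import Data.List.Relation.Binary.Permutation.Propositional using (_↭_; ↭-sym; ↭⇒↭ₛ)
open import Data.List.Relation.Binary.Permutation.Propositional.Properties using (++-comm; Any-resp-↭; ↭-length)
open import Data.List.Relation.Binary.Permutation.Setoid.Properties using (Unique-resp-↭)
open import Data.Product using (_×_; _,_; ∃; ∃₂; proj₁; proj₂)
open import Data.Sum using (_⊎_; inj₁; inj₂)
open import Data.Empty using (⊥; ⊥-elim)
open import Data.Unit using (tt)
open import Function using (_∘_; id; case_of_)
open import Function.Bundles using (Equivalence)
open import Function.Definitions using (Injective)
open import Algebra.Properties.CommutativeSemigroup +-commutativeSemigroup using (interchange; xy∙z≈xz∙y)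
open import Relation.Nullary using (¬_; yes; no)
open import Relation.Nullary.Decidable using (⌊_⌋; toWitness; fromWitness)
open import Relation.Binary.PropositionalEquality hiding ([_])

open Equivalence using (to; from)

T-not⁺ : ∀ {b} → ¬ T b → T (not b)
T-not⁺ {false} _ = tt
T-not⁺ {true} ¬t = ¬t tt

T-not⁻ : ∀ {b} → T (not b) → ¬ T b
T-not⁻ {true} ()

ind : Bool → ℕ
ind b = if b then 1 else 0

ind-mono : ∀ {a b} → (T a → T b) → ind a ≤ ind b
ind-mono {false} _ = z≤n
ind-mono {true} {true} _ = ≤-refl
ind-mono {true} {false} a⇒b = ⊥-elim (a⇒b tt)

ind-≤-+ : ∀ {a b c} → (T a → T b ⊎ T c) → ind a ≤ ind b + ind c
ind-≤-+ {false} _ = z≤n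
ind-≤-+ {true} {true} _ = s≤s z≤n
ind-≤-+ {true} {false} {true} _ = ≤-refl
ind-≤-+ {true} {false} {false} cover with cover tt
... | inj₁ ()
... | inj₂ ()

ind-+-≤ : ∀ {a b c} → (T b → T a) → (T c → T a) → (T b → T c → ⊥) → ind b + ind c ≤ ind a
ind-+-≤ {b = false} {false} _ _ _ = z≤n
ind-+-≤ {b = true} {true} _ _ disjoint = ⊥-elim (disjoint tt tt)
ind-+-≤ {true} {true} {false} _ _ _ = ≤-refl
ind-+-≤ {true} {false} {true} _ _ _ = ≤-refl
ind-+-≤ {false} {true} {false} b⇒a _ _ = ⊥-elim (b⇒a tt)
ind-+-≤ {false} {false} {true} _ c⇒a _ = ⊥-elim (c⇒a tt)

-- `count p` of Defs is, by definition, `cnt p (allFin n)`.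
cnt : {A : Set} → (A → Bool) → List A → ℕ
cnt p xs = sum (map (λ v → ind (p v)) xs)

module _ {A : Set} where

  sum-map-mono : ∀ {f g : A → ℕ} → (∀ v → f v ≤ g v) → ∀ xs → sum (map f xs) ≤ sum (map g xs)
  sum-map-mono f≤g [] = z≤n
  sum-map-mono f≤g (v ∷ xs) = +-mono-≤ (f≤g v) (sum-map-mono f≤g xs)

  sum-map-+ : ∀ (f g : A → ℕ) xs → sum (map (λ v → f v + g v) xs) ≡ sum (map f xs) + sum (map g xs)
  sum-map-+ f g [] = refl
  sum-map-+ f g (v ∷ xs) =
    trans (cong (f v + g v +_) (sum-map-+ f g xs)) (interchange (f v) (g v) _ _)

  cnt-mono : ∀ {p q : A → Bool} → (∀ v → T (p v) → T (q v)) → ∀ xs → cnt p xs ≤ cnt q xs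
  cnt-mono p⇒q = sum-map-mono (λ v → ind-mono (p⇒q v))

  cnt-≤-+ : ∀ {p q r : A → Bool} → (∀ v → T (p v) → T (q v) ⊎ T (r v)) →
            ∀ xs → cnt p xs ≤ cnt q xs + cnt r xs
  cnt-≤-+ {q = q} {r} cover xs = ≤-trans (sum-map-mono (λ v → ind-≤-+ (cover v)) xs)
                                        (≤-reflexive (sum-map-+ (ind ∘ q) (ind ∘ r) xs))

  cnt-+-≤ : ∀ {p q r : A → Bool} → (∀ v → T (q v) → T (p v)) → (∀ v → T (r v) → T (p v)) →
            (∀ v → T (q v) → T (r v) → ⊥) → ∀ xs → cnt q xs + cnt r xs ≤ cnt p xs
  cnt-+-≤ {q = q} {r} q⇒p r⇒p disjoint xs =
    ≤-trans (≤-reflexive (sym (sum-map-+ (ind ∘ q) (ind ∘ r) xs)))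
            (sum-map-mono (λ v → ind-+-≤ (q⇒p v) (r⇒p v) (disjoint v)) xs)

  cnt-+-cnt-not : ∀ (p : A → Bool) xs → cnt p xs + cnt (λ v → not (p v)) xs ≡ cnt (λ _ → true) xs
  cnt-+-cnt-not p [] = refl
  cnt-+-cnt-not p (v ∷ xs) with p v
  ... | true = cong suc (cnt-+-cnt-not p xs)
  ... | false = trans (+-suc _ _) (cong suc (cnt-+-cnt-not p xs))

  cnt≡0 : ∀ {p : A → Bool} {xs} → All (λ v → ¬ T (p v)) xs → cnt p xs ≡ 0
  cnt≡0 All.[] = refl
  cnt≡0 {p} (All._∷_ {v} ¬pv ¬pxs) with p v
  ... | true = ⊥-elim (¬pv tt)
  ... | false = cnt≡0 ¬pxs

  cnt≤1 : ∀ {p : A → Bool} → (∀ {a b} → T (p a) → T (p b) → a ≡ b) →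
          ∀ {xs} → Unique xs → cnt p xs ≤ 1
  cnt≤1 p-unique [] = z≤n
  cnt≤1 {p} p-unique (_∷_ {v} v∉xs xs-unique) with p v in pv
  ... | false = cnt≤1 p-unique xs-unique
  ... | true =
    ≤-reflexive (cong suc (cnt≡0 (All.map (λ v≢w pw → v≢w (p-unique (subst T (sym pv) tt) pw)) v∉xs)))

  cnt-pos : ∀ {p : A → Bool} {a xs} → a ∈ xs → T (p a) → 1 ≤ cnt p xs
  cnt-pos {p} {xs = v ∷ _} (here refl) pa with p v
  ... | true = s≤s z≤n
  ... | false = ⊥-elim pa
  cnt-pos {xs = v ∷ _} (there a∈) pa = ≤-trans (cnt-pos a∈ pa) (m≤n+m _ _)

  cnt-two : ∀ {p : A → Bool} {a b xs} → a ∈ xs → b ∈ xs → a ≢ b → T (p a) → T (p b) → 2 ≤ cnt p xs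
  cnt-two (here refl) (here refl) a≢b _ _ = ⊥-elim (a≢b refl)
  cnt-two {p} {xs = v ∷ _} (here refl) (there b∈) _ pa pb with p v
  ... | true = s≤s (cnt-pos b∈ pb)
  ... | false = ⊥-elim pa
  cnt-two {p} {xs = v ∷ _} (there a∈) (here refl) _ pa pb with p v
  ... | true = s≤s (cnt-pos a∈ pa)
  ... | false = ⊥-elim pb
  cnt-two {xs = v ∷ _} (there a∈) (there b∈) a≢b pa pb = ≤-trans (cnt-two a∈ b∈ a≢b pa pb) (m≤n+m _ _)

  cnt<length⇒∃¬ : ∀ (p : A → Bool) xs → cnt p xs < length xs → ∃ λ a → a ∈ xs × ¬ T (p a)
  cnt<length⇒∃¬ p (v ∷ xs) lt with p v in pv
  ... | false = v , here refl , subst T pv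
  ... | true with cnt<length⇒∃¬ p xs (≤-pred lt)
  ... |   a , a∈ , ¬pa = a , there a∈ , ¬pa

  cnt-markov : ∀ t (g : A → ℕ) xs → t * cnt (λ a → ⌊ t ≤? g a ⌋) xs ≤ sum (map g xs)
  cnt-markov t g [] = ≤-reflexive (*-zeroʳ t)
  cnt-markov t g (v ∷ xs) with t ≤? g v
  ... | yes t≤gv = ≤-trans (≤-reflexive (*-suc t _)) (+-mono-≤ t≤gv (cnt-markov t g xs))
  ... | no _ = ≤-trans (cnt-markov t g xs) (m≤n+m _ _)

  cnt-fibres : ∀ (p : A → Bool) (f : A → ℕ) {cols} → Unique cols → ∀ xs →
               sum (map (λ col → cnt (λ v → p v ∧ ⌊ f v ℕ.≟ col ⌋) xs) cols) ≤ cnt p xs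
  cnt-fibres p f cols-unique xs =
    ≤-trans (fibres cols-unique) (cnt-mono (λ v → proj₁ ∘ to (T-∧ {p v})) xs)
    where
      colour∈ : List ℕ → A → Bool
      colour∈ cols v = any (λ col → ⌊ f v ℕ.≟ col ⌋) cols

      fibres : ∀ {cols} → Unique cols →
               sum (map (λ col → cnt (λ v → p v ∧ ⌊ f v ℕ.≟ col ⌋) xs) cols) ≤
               cnt (λ v → p v ∧ colour∈ cols v) xs
      fibres [] = z≤n
      fibres {col ∷ cols} (col∉ ∷ cols-unique) =
        ≤-trans (+-monoʳ-≤ _ (fibres cols-unique)) (cnt-+-≤ head tail disjoint xs)
        where
          head : ∀ v → T (p v ∧ ⌊ f v ℕ.≟ col ⌋) → T (p v ∧ colour∈ (col ∷ cols) v)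
          head v t = let (pv , fv≡col) = to (T-∧ {p v}) t in from (T-∧ {p v}) (pv , from T-∨ (inj₁ fv≡col))
          tail : ∀ v → T (p v ∧ colour∈ cols v) → T (p v ∧ colour∈ (col ∷ cols) v)
          tail v t = let (pv , fv∈) = to (T-∧ {p v}) t in
                     from (T-∧ {p v}) (pv , from (T-∨ {⌊ f v ℕ.≟ col ⌋}) (inj₂ fv∈))
          disjoint : ∀ v → T (p v ∧ ⌊ f v ℕ.≟ col ⌋) → T (p v ∧ colour∈ cols v) → ⊥
          disjoint v t t′ =
            All¬⇒¬Any col∉
              (Any.map (λ fv≡ → trans (sym (toWitness (proj₂ (to (T-∧ {p v}) t)))) (toWitness fv≡))
                       (any⁻ _ cols (proj₂ (to (T-∧ {p v}) t′))))

2*m≤2*n+1⇒m≤n : ∀ {m n} → 2 * m ≤ 2 * n + 1 → m ≤ n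
2*m≤2*n+1⇒m≤n {m} {n} 2m≤2n+1 = ≤-pred (*-cancelˡ-< 2 m (suc n) (begin-strict
  2 * m      ≤⟨ 2m≤2n+1 ⟩
  2 * n + 1  <⟨ s≤s (≤-reflexive (+-comm (2 * n) 1)) ⟩
  2 + 2 * n  ≡⟨ *-suc 2 n ⟨
  2 * suc n  ∎))
  where open ≤-Reasoning

m+k≤n⇒⌈m/k⌉+1≤⌈n/k⌉ : ∀ {m n} k → m + suc k ≤ n → ⌈ m / suc k ⌉ + 1 ≤ ⌈ n / suc k ⌉
m+k≤n⇒⌈m/k⌉+1≤⌈n/k⌉ {m} {n} k m+k≤n = begin
  (m + k) / suc k + 1              ≡⟨ cong ((m + k) / suc k +_) (n/n≡1 (suc k)) ⟨
  (m + k) / suc k + suc k / suc k  ≡⟨ +-distrib-/-∣ʳ (m + k) ∣-refl ⟨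
  (m + k + suc k) / suc k          ≡⟨ cong (_/ suc k) (xy∙z≈xz∙y m k (suc k)) ⟩
  (m + suc k + k) / suc k          ≤⟨ /-monoˡ-≤ (suc k) (+-monoˡ-≤ k m+k≤n) ⟩
  (n + k) / suc k                  ∎
  where open ≤-Reasoning

-- The last index has the fewest admissible colours, so it is served first and its colour
-- is then forbidden for the others.
distinct-choice : ∀ {m} (Ls : Fin m → List ℕ) (bad : Fin m → ℕ → Bool) →
  (∀ i → Unique (Ls i)) →
  (∀ i → cnt (bad i) (Ls i) + m ≤ length (Ls i) + toℕ i) →
  ∃ λ (d : Fin m → ℕ) → (∀ i → d i ∈ Ls i) × (∀ i → ¬ T (bad i (d i))) × Injective _≡_ _≡_ d
distinct-choice {zero} Ls bad _ _ = (λ ()) , (λ ()) , (λ ()) , λ { {()} }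
distinct-choice {suc m} Ls bad Ls-unique room
  with cnt<length⇒∃¬ (bad (fromℕ m)) (Ls (fromℕ m)) room-last
  where
    room-last : cnt (bad (fromℕ m)) (Ls (fromℕ m)) < length (Ls (fromℕ m))
    room-last = +-cancelʳ-≤ m _ _ (subst₂ _≤_ (+-suc _ m) (cong (length (Ls (fromℕ m)) +_) (toℕ-fromℕ m))
                                              (room (fromℕ m)))
... | c , c∈ , c-good
  with distinct-choice (Ls ∘ inject₁) (λ i a → bad (inject₁ i) a ∨ ⌊ a ℕ.≟ c ⌋) (Ls-unique ∘ inject₁) room′
  where
    room′ : ∀ i → cnt (λ a → bad (inject₁ i) a ∨ ⌊ a ℕ.≟ c ⌋) (Ls (inject₁ i)) + m ≤
                  length (Ls (inject₁ i)) + toℕ i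
    room′ i = begin
      cnt (λ a → bad (inject₁ i) a ∨ ⌊ a ℕ.≟ c ⌋) L + m
        ≤⟨ +-monoˡ-≤ m (cnt-≤-+ (λ _ → to T-∨) L) ⟩
      cnt (bad (inject₁ i)) L + cnt (λ a → ⌊ a ℕ.≟ c ⌋) L + m
        ≤⟨ +-monoˡ-≤ m (+-monoʳ-≤ _ (cnt≤1 (λ a≡c b≡c → trans (toWitness a≡c) (sym (toWitness b≡c)))
                                            (Ls-unique (inject₁ i)))) ⟩
      cnt (bad (inject₁ i)) L + 1 + m   ≡⟨ +-assoc _ 1 m ⟩
      cnt (bad (inject₁ i)) L + suc m   ≤⟨ room (inject₁ i) ⟩
      length L + toℕ (inject₁ i)        ≡⟨ cong (length L +_) (toℕ-inject₁ i) ⟩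
      length L + toℕ i                  ∎
      where
        open ≤-Reasoning
        L = Ls (inject₁ i)
... | d′ , d′∈ , d′-good , d′-inj =
  pick ∘ view , pick-∈ ∘ view , pick-good ∘ view , λ {i} {j} → pick-inj (view i) (view j)
  where
    pick : ∀ {i} → View i → ℕ
    pick ‵fromℕ = c
    pick (‵inject₁ j) = d′ j

    pick-∈ : ∀ {i} (vi : View i) → pick vi ∈ Ls i
    pick-∈ ‵fromℕ = c∈
    pick-∈ (‵inject₁ j) = d′∈ j

    pick-good : ∀ {i} (vi : View i) → ¬ T (bad i (pick vi))
    pick-good ‵fromℕ = c-good
    pick-good (‵inject₁ j) = d′-good j ∘ from T-∨ ∘ inj₁

    d′-fresh : ∀ j → d′ j ≢ c
    d′-fresh j = d′-good j ∘ from (T-∨ {bad (inject₁ j) (d′ j)}) ∘ inj₂ ∘ fromWitness {a? = d′ j ℕ.≟ c}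

    pick-inj : ∀ {i j} (vi : View i) (vj : View j) → pick vi ≡ pick vj → i ≡ j
    pick-inj ‵fromℕ ‵fromℕ _ = refl
    pick-inj ‵fromℕ (‵inject₁ j) c≡d′j = ⊥-elim (d′-fresh j (sym c≡d′j))
    pick-inj (‵inject₁ i) ‵fromℕ d′i≡c = ⊥-elim (d′-fresh i d′i≡c)
    pick-inj (‵inject₁ i) (‵inject₁ j) d′i≡d′j = cong inject₁ (d′-inj d′i≡d′j)

module _ {n} (G : Graph n) where

  open import Data.List.Membership.DecPropositional (F._≟_ {n}) using (_∈?_)

  Edge-sym : ∀ {u v} → Edge G u v → Edge G v u
  Edge-sym {u} {v} = subst T (Graph.sym G u v)

  Edge-irrefl : ∀ {v} → ¬ Edge G v v
  Edge-irrefl {v} = subst T (irref G v)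

  Chain-++⁻ : ∀ xs {y} ys → Chain G (xs ++ y ∷ ys) → Chain G (xs ++ [ y ]) × Chain G (y ∷ ys)
  Chain-++⁻ [] ys chain = _ , chain
  Chain-++⁻ (a ∷ []) ys (e , chain) = (e , _) , chain
  Chain-++⁻ (a ∷ b ∷ xs) ys (e , chain) =
    let (left , right) = Chain-++⁻ (b ∷ xs) ys chain in (e , left) , right

  Chain-++⁺ : ∀ xs {y} ys → Chain G (xs ++ [ y ]) → Chain G (y ∷ ys) → Chain G (xs ++ y ∷ ys)
  Chain-++⁺ [] ys _ right = right
  Chain-++⁺ (a ∷ []) ys (e , _) right = e , right
  Chain-++⁺ (a ∷ b ∷ xs) ys (e , left) right = e , Chain-++⁺ (b ∷ xs) ys left right

  Chain-last : ∀ xs {y z} → Chain G (xs ++ y ∷ [ z ]) → Edge G y z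
  Chain-last xs chain = proj₁ (proj₂ (Chain-++⁻ xs [ _ ] chain))

  Chain-rotate : ∀ pre w post → Chain G ((pre ++ w ∷ post) ++ take 1 (pre ++ w ∷ post)) →
                 Chain G (w ∷ (post ++ pre) ++ [ w ])
  Chain-rotate [] w post chain rewrite ++-identityʳ post = chain
  Chain-rotate (p ∷ pre) w post chain rewrite ++-assoc (p ∷ pre) (w ∷ post) [ p ] =
    let (left , right) = Chain-++⁻ (p ∷ pre) (post ++ [ p ]) chain in
    subst (Chain G) (sym (++-assoc (w ∷ post) (p ∷ pre) [ w ]))
      (Chain-++⁺ (w ∷ post) (pre ++ [ w ]) (subst (Chain G) (++-assoc [ w ] post [ p ]) right) left)

  closed-chain-neighbours : ∀ {w} rest → 2 ≤ length rest → Unique rest → Chain G (w ∷ rest ++ [ w ]) →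
                            ∃₂ λ a b → a ≢ b × Edge G w a × Edge G w b × a ∈ rest × b ∈ rest
  closed-chain-neighbours {w} (a ∷ t) 2≤len (a∉t ∷ _) chain with initLast t
  ... | [] = ⊥-elim (<-irrefl refl 2≤len)
  ... | mid ∷ʳ′ b = a , b , All.lookup a∉t b∈ , proj₁ chain , Edge-sym b–w , here refl , there b∈
    where
      b∈ : b ∈ mid ++ [ b ]
      b∈ = ∈-++⁺ʳ mid (here refl)
      b–w : Edge G b w
      b–w = Chain-last (w ∷ a ∷ mid) (subst (λ z → Chain G (w ∷ a ∷ z)) (++-assoc mid [ b ] [ w ]) chain)

  cycle-neighbours : ∀ {P vs w} → IsCycleIn G P vs → w ∈ vs →
                     ∃₂ λ a b → a ≢ b × Edge G w a × Edge G w b × a ∈ vs × b ∈ vs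
  cycle-neighbours {w = w} (3≤len , vs-unique , _ , chain) w∈ with ∈-∃++ w∈
  ... | pre , post , refl =
    let (a , b , a≢b , w–a , w–b , a∈ , b∈) =
          closed-chain-neighbours (post ++ pre) 2≤len rest-unique (Chain-rotate pre w post chain)
    in a , b , a≢b , w–a , w–b , back a∈ , back b∈
    where
      rotation : pre ++ w ∷ post ↭ w ∷ post ++ pre
      rotation = ++-comm pre (w ∷ post)
      2≤len : 2 ≤ length (post ++ pre)
      2≤len = ≤-pred (≤-trans 3≤len (≤-reflexive (↭-length rotation)))
      rest-unique : Unique (post ++ pre)
      rest-unique with Unique-resp-↭ (setoid _) (↭⇒↭ₛ rotation) vs-unique
      ... | _ ∷ unique = unique
      back : ∀ {v} → v ∈ post ++ pre → v ∈ pre ++ w ∷ post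
      back = Any-resp-↭ (↭-sym rotation) ∘ there

  acyclic-mono : ∀ {P Q : Fin n → Bool} → (∀ v → T (Q v) → T (P v)) → AcyclicIn G P → AcyclicIn G Q
  acyclic-mono Q⇒P P-acyclic vs (3≤len , vs-unique , allQ , chain) =
    P-acyclic vs (3≤len , vs-unique , All.map (Q⇒P _) allQ , chain)

  acyclic-add-vertex : ∀ {P Q : Fin n → Bool} w → AcyclicIn G P →
    (∀ v → T (Q v) → v ≡ w ⊎ T (P v)) →
    (∀ {a b} → Edge G w a → Edge G w b → T (P a) → T (P b) → a ≡ b) →
    AcyclicIn G Q
  acyclic-add-vertex {P} w P-acyclic Q⊆w+P w-leaf vs cycle@(3≤len , vs-unique , allQ , chain) =
    case w ∈? vs of λ where
      (no w∉) → P-acyclic vs (3≤len , vs-unique , All.tabulate (λ v∈ → inP v∈ (λ { refl → w∉ v∈ })) , chain)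
      (yes w∈) → let (a , b , a≢b , w–a , w–b , a∈ , b∈) = cycle-neighbours cycle w∈ in
                 a≢b (w-leaf w–a w–b (inP a∈ (≢w w–a)) (inP b∈ (≢w w–b)))
    where
      ≢w : ∀ {v} → Edge G w v → v ≢ w
      ≢w w–v refl = Edge-irrefl w–v
      inP : ∀ {v} → v ∈ vs → v ≢ w → T (P v)
      inP {v} v∈ v≢w with Q⊆w+P v (All.lookup allQ v∈)
      ... | inj₁ v≡w = ⊥-elim (v≢w v≡w)
      ... | inj₂ pv = pv

module _ {n k} (x : Fin k → Fin n) where

  inS-x : ∀ j → T (inS x (x j))
  inS-x j = any⁺ _ (Any.map (λ { refl → fromWitness refl }) (∈-allFin j))

  inS-∃ : ∀ {v} → T (inS x v) → ∃ λ j → x j ≡ v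
  inS-∃ t = let (j , xj≟v) = satisfied (any⁻ _ (allFin k) t) in j , toWitness xj≟v

  count-image : Injective _≡_ _≡_ x → ∀ {js} → Unique js →
                length js ≤ cnt (λ v → any (λ j → ⌊ x j F.≟ v ⌋) js) (allFin n)
  count-image x-inj [] = z≤n
  count-image x-inj {j ∷ js} (j∉ ∷ js-unique) =
    ≤-trans (+-mono-≤ (cnt-pos (∈-allFin (x j)) (fromWitness refl)) (count-image x-inj js-unique))
            (cnt-+-≤ (λ _ → from T-∨ ∘ inj₁) (λ v → from (T-∨ {⌊ x j F.≟ v ⌋}) ∘ inj₂) disjoint (allFin n))
    where
      disjoint : ∀ v → T ⌊ x j F.≟ v ⌋ → T (any (λ j′ → ⌊ x j′ F.≟ v ⌋) js) → ⊥
      disjoint v xj≡v t =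
        All¬⇒¬Any j∉ (Any.map (λ xj′≡v → x-inj (trans (toWitness xj≡v) (sym (toWitness xj′≡v)))) (any⁻ _ js t))

  count-outsideS : Injective _≡_ _≡_ x → count (outsideS x) + k ≤ count {n} (λ _ → true)
  count-outsideS x-inj = begin
    count (outsideS x) + k                  ≤⟨ +-monoʳ-≤ _ k≤count-inS ⟩
    count (outsideS x) + count (inS x)      ≡⟨ +-comm _ (count (inS x)) ⟩
    count (inS x) + count (outsideS x)      ≡⟨ cnt-+-cnt-not (inS x) (allFin n) ⟩
    count {n} (λ _ → true)                      ∎
    where
      open ≤-Reasoning
      k≤count-inS : k ≤ count (inS x)
      k≤count-inS = subst (_≤ count (inS x)) (length-tabulate id) (count-image x-inj (allFin⁺ k))

  extend : (Fin n → ℕ) → (Fin k → ℕ) → Fin n → ℕ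
  extend c₀ d v with any? (λ j → x j F.≟ v)
  ... | yes (j , _) = d j
  ... | no _ = c₀ v

  module _ {c₀ : Fin n → ℕ} {d : Fin k → ℕ} where

    extend-pointwise : (R : Fin n → ℕ → Set) →
                       (∀ j → R (x j) (d j)) → (∀ v → T (outsideS x v) → R v (c₀ v)) →
                       ∀ v → R v (extend c₀ d v)
    extend-pointwise R onS offS v with any? (λ j → x j F.≟ v)
    ... | yes (j , refl) = onS j
    ... | no ∄ = offS v (T-not⁺ (∄ ∘ inS-∃))

    extend-class : ∀ {col v} → T ⌊ extend c₀ d v ℕ.≟ col ⌋ →
                   (∃ λ j → x j ≡ v × d j ≡ col) ⊎ T (outsideS x v ∧ ⌊ c₀ v ℕ.≟ col ⌋)
    extend-class {col} {v} t with any? (λ j → x j F.≟ v)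
    ... | yes (j , xj≡v) = inj₁ (j , xj≡v , toWitness t)
    ... | no ∄ = inj₂ (from (T-∧ {outsideS x v}) (T-not⁺ (∄ ∘ inS-∃) , t))

    extend-class-inS : ∀ {col v} → T (inS x v ∧ ⌊ extend c₀ d v ℕ.≟ col ⌋) → ∃ λ j → x j ≡ v × d j ≡ col
    extend-class-inS {v = v} t with to (T-∧ {inS x v}) t
    ... | v∈S , has-col with extend-class has-col
    ... | inj₁ found = found
    ... | inj₂ v∉S = ⊥-elim (T-not⁻ (proj₁ (to (T-∧ {outsideS x v}) v∉S)) v∈S)

module _ {n k} (G : Graph n) (x : Fin k → Fin n) (c₀ : Fin n → ℕ) where

  class₀ : ℕ → Fin n → Bool
  class₀ col v = outsideS x v ∧ ⌊ c₀ v ℕ.≟ col ⌋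

  crowded : Fin k → ℕ → Bool
  crowded i col = ⌊ 2 ≤? cnt (λ v → (adj G (x i) v ∧ outsideS x v) ∧ ⌊ c₀ v ℕ.≟ col ⌋) (allFin n) ⌋

  cnt-crowded : ∀ i {cols} → Unique cols → count (λ v → adj G (x i) v ∧ outsideS x v) ≤ 2 * toℕ i + 1 →
                cnt (crowded i) cols ≤ toℕ i
  cnt-crowded i {cols} cols-unique deg = 2*m≤2*n+1⇒m≤n (begin
    2 * cnt (crowded i) cols
      ≤⟨ cnt-markov 2 _ cols ⟩
    sum (map (λ col → cnt (λ v → (adj G (x i) v ∧ outsideS x v) ∧ ⌊ c₀ v ℕ.≟ col ⌋) (allFin n)) cols)
      ≤⟨ cnt-fibres _ c₀ cols-unique (allFin n) ⟩
    count (λ v → adj G (x i) v ∧ outsideS x v)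
      ≤⟨ deg ⟩
    2 * toℕ i + 1 ∎)
    where open ≤-Reasoning

  uncrowded-leaf : ∀ {i col} → ¬ T (crowded i col) →
                   ∀ {a b} → Edge G (x i) a → Edge G (x i) b → T (class₀ col a) → T (class₀ col b) → a ≡ b
  uncrowded-leaf {i} {col} uncrowded {a} {b} x–a x–b a∈ b∈ with a F.≟ b
  ... | yes a≡b = a≡b
  ... | no a≢b =
    ⊥-elim (uncrowded (fromWitness (cnt-two (∈-allFin a) (∈-allFin b) a≢b (near x–a a∈) (near x–b b∈))))
    where
      near : ∀ {v} → Edge G (x i) v → T (class₀ col v) →
             T ((adj G (x i) v ∧ outsideS x v) ∧ ⌊ c₀ v ℕ.≟ col ⌋)
      near {v} x–v v∈ = subst T (sym (∧-assoc (adj G (x i) v) _ _)) (from (T-∧ {adj G (x i) v}) (x–v , v∈))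

  module _ (d : Fin k → ℕ) (d-inj : Injective _≡_ _≡_ d) (d-uncrowded : ∀ i → ¬ T (crowded i (d i))) where

    extend-acyclic : ∀ {col} → AcyclicIn G (class₀ col) → AcyclicIn G (λ v → ⌊ extend x c₀ d v ℕ.≟ col ⌋)
    extend-acyclic {col} class-acyclic with any? (λ j → d j ℕ.≟ col)
    ... | yes (j , refl) = acyclic-add-vertex G (x j) class-acyclic into (uncrowded-leaf (d-uncrowded j))
      where
        into : ∀ v → T ⌊ extend x c₀ d v ℕ.≟ d j ⌋ → v ≡ x j ⊎ T (class₀ (d j) v)
        into v t with extend-class x t
        ... | inj₁ (j′ , refl , dj′≡dj) = inj₁ (cong x (d-inj dj′≡dj))
        ... | inj₂ v∈class = inj₂ v∈class
    ... | no ∄ = acyclic-mono G into class-acyclic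
      where
        into : ∀ v → T ⌊ extend x c₀ d v ℕ.≟ col ⌋ → T (class₀ col v)
        into v t with extend-class x t
        ... | inj₁ (j , _ , dj≡col) = ⊥-elim (∄ (j , dj≡col))
        ... | inj₂ v∈class = v∈class

    extend-count : ∀ col → count (λ v → ⌊ extend x c₀ d v ℕ.≟ col ⌋) ≤ count (class₀ col) + 1
    extend-count col = ≤-trans (cnt-≤-+ split (allFin n)) (+-monoʳ-≤ _ (cnt≤1 one-in-S (allFin⁺ n)))
      where
        split : ∀ v → T ⌊ extend x c₀ d v ℕ.≟ col ⌋ →
                T (class₀ col v) ⊎ T (inS x v ∧ ⌊ extend x c₀ d v ℕ.≟ col ⌋)
        split v t with extend-class x t
        ... | inj₁ (j , refl , _) = inj₂ (from (T-∧ {inS x (x j)}) (inS-x x j , t))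
        ... | inj₂ v∈class = inj₁ v∈class
        one-in-S : ∀ {a b} → T (inS x a ∧ ⌊ extend x c₀ d a ℕ.≟ col ⌋) →
                   T (inS x b ∧ ⌊ extend x c₀ d b ℕ.≟ col ⌋) → a ≡ b
        one-in-S ta tb with extend-class-inS x ta | extend-class-inS x tb
        ... | ja , refl , dja≡col | jb , refl , djb≡col = cong x (d-inj (trans dja≡col (sym djb≡col)))

lemma1 : ∀ {n} (G : Graph n) (k : ℕ) → 1 ≤ k →
    (x : Fin k → Fin n) → Injective _≡_ _≡_ x →
    ELPA-on G (outsideS x) k →
    (∀ (i : Fin k) → count (λ v → adj G (x i) v ∧ outsideS x v) ≤ 2 * toℕ i + 1) →
    ELPA G k
lemma1 G zero () x x-inj G-S-arborable deg
lemma1 {n} G (suc k) _ x x-inj G-S-arborable deg L L-ok =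
  let (c₀ , c₀∈L , c₀-acyclic , c₀-count) = G-S-arborable L (λ v _ → L-ok v tt)
      (d , d∈L , d-uncrowded , d-inj) = distinct-choice (L ∘ x) (crowded G x c₀) (proj₂ ∘ L-ok′ ∘ x) (room c₀)
  in extend x c₀ d ,
     (λ v _ → extend-pointwise x (λ v col → col ∈ L v) d∈L c₀∈L v) ,
     (λ col → extend-acyclic G x c₀ d d-inj d-uncrowded (c₀-acyclic col)) ,
     λ col → begin
       count (λ v → ⌊ extend x c₀ d v ℕ.≟ col ⌋)   ≤⟨ extend-count G x c₀ d d-inj d-uncrowded col ⟩
       count (class₀ G x c₀ col) + 1              ≤⟨ +-monoˡ-≤ 1 (c₀-count col) ⟩
       ⌈ count (outsideS x) / suc k ⌉ + 1         ≤⟨ m+k≤n⇒⌈m/k⌉+1≤⌈n/k⌉ k (count-outsideS x x-inj) ⟩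
       ⌈ count {n} (λ _ → true) / suc k ⌉         ∎
  where
    open ≤-Reasoning
    L-ok′ : ∀ v → length (L v) ≡ suc k × Unique (L v)
    L-ok′ v = L-ok v tt
    room : ∀ c₀ i → cnt (crowded G x c₀ i) (L (x i)) + suc k ≤ length (L (x i)) + toℕ i
    room c₀ i rewrite proj₁ (L-ok′ (x i)) =
      ≤-trans (≤-reflexive (+-comm _ (suc k)))
              (+-monoʳ-≤ (suc k) (cnt-crowded G x c₀ i (proj₂ (L-ok′ (x i))) (deg i)))
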